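{- Let $G$ be a finite, connected multigraph without loop edges, $q\in V(G)$, and $D\in\operatorname{Div}(G)$. (a) If $E=D+\Delta(f)$ for some $f:V(G)\to\mathbb{Z}$, then $b_q(E)=b_q(D)+\sum_{v\in V(G)}(f(v)-f(q))$. (b) If $E=D-\Delta(\chi_A)$ for some $A\subseteq V(G)\setminus\{q\}$, then $b_q(E)=b_q(D)-|A|$.
   Context: $\operatorname{Div}(G)$ is the free abelian group on $V(G)$, $\deg(D)=\sum_vD(v)$. $\Delta(f)=\sum_v\Delta_v(f)(v)$ with $\Delta_v(f)=\sum_{\{v,w\}\in E(G)}(f(v)-f(w))$ (edges with multiplicity), for rational-valued $f$. $\chi_A$ is the indicator function of $A$. Energy pairing on degree-zero divisors: if $D_i=\Delta(f_i)$ with $f_i$ rational-valued, $\langle D_1,D_2\rangle=\sum_v f_1(v)D_2(v)$. $\langle D,E\rangle_q=\langle D-\deg(D)(q),E-\deg(E)(q)\rangle$. With $\mathbf{1}=\sum_{v\in V(G)}(v)$, $b_q(D)=\langle\mathbf{1},D\rangle_q$. -}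

module Defs where

open import Data.Nat as ℕ using (ℕ; zero; suc)
open import Data.Integer as ℤ using (ℤ)
open import Data.Rational as ℚ using (ℚ)
open import Data.Fin using (Fin; zero; suc)
open import Data.Fin.Subset using (Subset)
open import Data.Vec using (lookup)
open import Data.Bool using (Bool; true; false; if_then_else_)
open import Data.Product using (Σ; _×_)
open import Relation.Binary.PropositionalEquality using (_≡_)
open import Relation.Nullary using (Dec; does)
open import Data.Fin using (_≟_)

record Multigraph : Set where
  field
    n        : ℕ
    mult     : Fin n → Fin n → ℕ
    symm     : ∀ u v → mult u v ≡ mult v u
    loopless : ∀ v → mult v v ≡ 0

open Multigraph public

data Reachable (G : Multigraph) : Fin (n G) → Fin (n G) → Set where
  here : ∀ {v} → Reachable G v v
  step : ∀ {u w v} → 0 ℕ.< mult G u w → Reachable G w v → Reachable G u v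

Connected : Multigraph → Set
Connected G = ∀ u v → Reachable G u v

sumℤ : ∀ {k} → (Fin k → ℤ) → ℤ
sumℤ {zero}  f = ℤ.0ℤ
sumℤ {suc k} f = f zero ℤ.+ sumℤ (λ i → f (suc i))

sumℚ : ∀ {k} → (Fin k → ℚ) → ℚ
sumℚ {zero}  f = ℚ.0ℚ
sumℚ {suc k} f = f zero ℚ.+ sumℚ (λ i → f (suc i))

Div : Multigraph → Set
Div G = Fin (n G) → ℤ

deg : (G : Multigraph) → Div G → ℤ
deg G D = sumℤ D

_+D_ : ∀ {G : Multigraph} → Div G → Div G → Div G
(D +D E) v = D v ℤ.+ E v

_-D_ : ∀ {G : Multigraph} → Div G → Div G → Div G
(D -D E) v = D v ℤ.- E v

point : (G : Multigraph) → ℤ → Fin (n G) → Div G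
point G k q v = if does (v ≟ q) then k else ℤ.0ℤ

one : (G : Multigraph) → Div G
one G v = ℤ.1ℤ

Δ : (G : Multigraph) → (Fin (n G) → ℤ) → Div G
Δ G f v = sumℤ (λ w → ℤ.+ (mult G v w) ℤ.* (f v ℤ.- f w))

Δℚ : (G : Multigraph) → (Fin (n G) → ℚ) → Fin (n G) → ℚ
Δℚ G f v = sumℚ (λ w → (ℤ.+ (mult G v w) ℚ./ 1) ℚ.* (f v ℚ.- f w))

toℚ : ℤ → ℚ
toℚ z = z ℚ./ 1

-- Energy pairing on degree-zero divisors, as a relation:
-- EnergyPairing G D₁ D₂ x  iff  D₁ = Δ(f₁) for some rational f₁ and
-- x = Σ_v f₁(v) D₂(v).  (D₂ is also required to have degree zero.)
EnergyPairing : (G : Multigraph) → Div G → Div G → ℚ → Set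
EnergyPairing G D₁ D₂ x =
  deg G D₁ ≡ ℤ.0ℤ × deg G D₂ ≡ ℤ.0ℤ ×
  Σ (Fin (n G) → ℚ) (λ f₁ →
    (∀ v → Δℚ G f₁ v ≡ toℚ (D₁ v)) ×
    x ≡ sumℚ (λ v → f₁ v ℚ.* toℚ (D₂ v)))

PairingQ : (G : Multigraph) → Fin (n G) → Div G → Div G → ℚ → Set
PairingQ G q D E x =
  EnergyPairing G (_-D_ {G} D (point G (deg G D) q)) (_-D_ {G} E (point G (deg G E) q)) x

IsBq : (G : Multigraph) → Fin (n G) → Div G → ℚ → Set
IsBq G q D x = PairingQ G q (one G) D x

χ : (G : Multigraph) → Subset (n G) → Fin (n G) → ℤ
χ G A v = if lookup A v then ℤ.1ℤ else ℤ.0ℤ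

-- Write Dq = D − deg(D)·(q). Then bq(D) = Σ f₁ · Dq for any rational f₁ with Δf₁ = 1q, and
-- since Dq and 1q both have degree zero this is Σ_v (f₁(v) − f₁(q)) D(v). Such an f₁ exists
-- because Δ is symmetric and, on a connected graph, its kernel consists of the constants (maximum
-- principle), so by the Fredholm alternative it hits every vector orthogonal to the constants;
-- f₁ is unique up to a constant for the same reason. Replacing D by D + ΔF adds
-- Σ (f₁ − f₁(q)) ΔF = Σ F Δf₁ = Σ F · 1q = Σ_v (F(v) − F(q)) by self-adjointness of Δ.
-- Part (b) is the case F = −χ_A, where Σ_v (F(v) − F(q)) = −|A| because χ_A(q) = 0.
module Submission where

open import Defs
open import Data.Nat as ℕ using (zero; suc)
import Data.Nat.Properties as ℕP
open import Data.Integer as ℤ using (ℤ)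
import Data.Integer.Properties as ℤP
open import Data.Rational as ℚ using (ℚ; _+_; _*_; _-_; -_; 0ℚ; 1ℚ; _≤_)
import Data.Rational.Properties as ℚP
import Data.Rational.Unnormalised as ℚᵘ
import Data.Rational.Unnormalised.Properties as ℚᵘP
open import Data.Rational.Solver using (module +-*-Solver)
open +-*-Solver
open import Algebra.Bundles using (Ring)
open import Algebra.Properties.Semiring.Sum (Ring.semiring ℚP.+-*-ring)
  using (sum; sum-cong-≗; sum-replicate-zero; sum-remove; ∑-distrib-+; ∑-comm; *-distribˡ-sum; *-distribʳ-sum)
open import Algebra.Properties.Ring ℚP.+-*-ring using (-1*x≈-x)
open import Algebra.Properties.Group ℚP.+-0-group using (x≈y⇒x∙y⁻¹≈ε; x∙y⁻¹≈ε⇒x≈y)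
open import Data.Fin using (Fin; zero; suc; punchIn; punchOut) renaming (_≟_ to _≟ᶠ_)
open import Data.Fin.Properties using (punchInᵢ≢i; punchIn-punchOut; all?; ¬∀⟶∃¬)
open import Data.Fin.Subset using (Subset; _∉_; ∣_∣)
open import Data.Vec using ([]; _∷_; lookup)
open import Data.Vec.Properties using (lookup⇒[]=)
open import Data.Vec.Functional using (insertAt; removeAt)
open import Data.Vec.Functional.Properties using (insertAt-lookup; insertAt-punchIn)
open import Data.Bool using (true; false; if_then_else_)
open import Data.Sum as Sum using (_⊎_; inj₁; inj₂)
open import Data.Product using (Σ; ∃; _×_; _,_; proj₁; proj₂)
open import Data.Empty using (⊥-elim)
open import Function using (id; _∘_)
open import Relation.Nullary using (Dec; yes; no; does)
open import Relation.Binary.PropositionalEquality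
open ≡-Reasoning

sumℚ≡sum : ∀ {k} (f : Fin k → ℚ) → sumℚ f ≡ sum f
sumℚ≡sum {zero}  f = refl
sumℚ≡sum {suc k} f = cong (f zero +_) (sumℚ≡sum (λ i → f (suc i)))

sum-neg : ∀ {k} (f : Fin k → ℚ) → sum (λ i → - f i) ≡ - sum f
sum-neg f = begin
  sum (λ i → - f i)       ≡⟨ sum-cong-≗ (λ i → sym (-1*x≈-x (f i))) ⟩
  sum (λ i → - 1ℚ * f i)  ≡⟨ *-distribˡ-sum (- 1ℚ) f ⟨
  - 1ℚ * sum f            ≡⟨ -1*x≈-x (sum f) ⟩
  - sum f                 ∎

sum-sub : ∀ {k} (f g : Fin k → ℚ) → sum (λ i → f i - g i) ≡ sum f - sum g
sum-sub f g = trans (∑-distrib-+ f (λ i → - g i)) (cong (sum f +_) (sum-neg g))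

sum-supported : ∀ {k} (p : Fin k) (f : Fin k → ℚ) → (∀ j → j ≢ p → f j ≡ 0ℚ) → sum f ≡ f p
sum-supported {suc k} p f vanishes = begin
  sum f                     ≡⟨ sum-remove {i = p} f ⟩
  f p + sum (removeAt f p)  ≡⟨ cong (f p +_) (sum-cong-≗ (λ j → vanishes _ (punchInᵢ≢i p j))) ⟩
  f p + sum {k} (λ _ → 0ℚ)  ≡⟨ cong (f p +_) (sum-replicate-zero k) ⟩
  f p + 0ℚ                  ≡⟨ ℚP.+-identityʳ (f p) ⟩
  f p                       ∎

pointMass : ∀ {k} → Fin k → ℚ → Fin k → ℚ
pointMass p c j = if does (j ≟ᶠ p) then c else 0ℚ

pointMass-at : ∀ {k} (p : Fin k) c → pointMass p c p ≡ c
pointMass-at p c with p ≟ᶠ p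
... | yes _   = refl
... | no p≢p  = ⊥-elim (p≢p refl)

pointMass-off : ∀ {k} {p j : Fin k} c → j ≢ p → pointMass p c j ≡ 0ℚ
pointMass-off {p = p} {j} c j≢p with j ≟ᶠ p
... | yes j≡p = ⊥-elim (j≢p j≡p)
... | no _    = refl

sum-pointMass : ∀ {k} (p : Fin k) c (g : Fin k → ℚ) → sum (λ j → pointMass p c j * g j) ≡ c * g p
sum-pointMass p c g = begin
  sum (λ j → pointMass p c j * g j)
    ≡⟨ sum-supported p _ (λ j j≢p → trans (cong (_* g j) (pointMass-off c j≢p)) (ℚP.*-zeroˡ (g j))) ⟩
  pointMass p c p * g p  ≡⟨ cong (_* g p) (pointMass-at p c) ⟩
  c * g p                ∎

sum-nonNeg : ∀ {k} (f : Fin k → ℚ) → (∀ i → 0ℚ ≤ f i) → 0ℚ ≤ sum f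
sum-nonNeg {zero}  f _      = ℚP.≤-refl
sum-nonNeg {suc k} f nonNeg = ℚP.+-mono-≤ (nonNeg zero) (sum-nonNeg (λ i → f (suc i)) (λ i → nonNeg (suc i)))

term≤sum : ∀ {k} (f : Fin k → ℚ) → (∀ i → 0ℚ ≤ f i) → ∀ i → f i ≤ sum f
term≤sum {suc k} f nonNeg i = subst₂ _≤_ (ℚP.+-identityʳ (f i)) (sym (sum-remove {i = i} f))
  (ℚP.+-monoʳ-≤ (f i) (sum-nonNeg (removeAt f i) (λ j → nonNeg (punchIn i j))))

sum-nonNeg-≡0 : ∀ {k} (f : Fin k → ℚ) → (∀ i → 0ℚ ≤ f i) → sum f ≡ 0ℚ → ∀ i → f i ≡ 0ℚ
sum-nonNeg-≡0 f nonNeg sum≡0 i = ℚP.≤-antisym (subst (f i ≤_) sum≡0 (term≤sum f nonNeg i)) (nonNeg i)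

≤⇒0≤- : ∀ {a b} → a ≤ b → 0ℚ ≤ b - a
≤⇒0≤- {a} {b} a≤b = subst (_≤ b - a) (ℚP.+-inverseʳ a) (ℚP.+-monoˡ-≤ (- a) a≤b)

argmax : ∀ {k} → Fin k → (f : Fin k → ℚ) → ∃ λ M → ∀ i → f i ≤ f M
argmax {suc zero}    _ f = zero , λ { zero → ℚP.≤-refl }
argmax {suc (suc k)} _ f with argmax zero (λ i → f (suc i))
... | M , max with ℚP.≤-total (f zero) (f (suc M))
...   | inj₁ f0≤ = suc M , λ { zero → f0≤ ; (suc i) → max i }
...   | inj₂ ≤f0 = zero , λ { zero → ℚP.≤-refl ; (suc i) → ℚP.≤-trans (max i) ≤f0 }

-- toℚ z = z / 1 is fromℚᵘ (mkℚᵘ z 0), so its homomorphism laws are checked in ℚᵘ.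
toℚᵘ-toℚ : ∀ z → ℚ.toℚᵘ (toℚ z) ℚᵘ.≃ ℚᵘ.mkℚᵘ z 0
toℚᵘ-toℚ z = ℚP.toℚᵘ-fromℚᵘ (ℚᵘ.mkℚᵘ z 0)

toℚ-+ : ∀ a b → toℚ (a ℤ.+ b) ≡ toℚ a + toℚ b
toℚ-+ a b = ℚP.toℚᵘ-injective
  (ℚᵘP.≃-trans (toℚᵘ-toℚ (a ℤ.+ b))
  (ℚᵘP.≃-trans (ℚᵘ.*≡* same)
  (ℚᵘP.≃-sym (ℚᵘP.≃-trans (ℚP.toℚᵘ-homo-+ (toℚ a) (toℚ b))
                          (ℚᵘP.+-cong (toℚᵘ-toℚ a) (toℚᵘ-toℚ b))))))
  where
  same : (a ℤ.+ b) ℤ.* ℤ.1ℤ ≡ (a ℤ.* ℤ.1ℤ ℤ.+ b ℤ.* ℤ.1ℤ) ℤ.* ℤ.1ℤ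
  same = trans (ℤP.*-identityʳ _)
    (sym (trans (ℤP.*-identityʳ _) (cong₂ ℤ._+_ (ℤP.*-identityʳ a) (ℤP.*-identityʳ b))))

toℚ-* : ∀ a b → toℚ (a ℤ.* b) ≡ toℚ a * toℚ b
toℚ-* a b = ℚP.toℚᵘ-injective
  (ℚᵘP.≃-trans (toℚᵘ-toℚ (a ℤ.* b))
  (ℚᵘP.≃-trans (ℚᵘ.*≡* refl)
  (ℚᵘP.≃-sym (ℚᵘP.≃-trans (ℚP.toℚᵘ-homo-* (toℚ a) (toℚ b))
                          (ℚᵘP.*-cong (toℚᵘ-toℚ a) (toℚᵘ-toℚ b))))))

toℚ-neg : ∀ a → toℚ (ℤ.- a) ≡ - toℚ a
toℚ-neg a = ℚP.toℚᵘ-injective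
  (ℚᵘP.≃-trans (toℚᵘ-toℚ (ℤ.- a))
  (ℚᵘP.≃-sym (ℚᵘP.≃-trans (ℚP.toℚᵘ-homo‿- (toℚ a)) (ℚᵘP.-‿cong (toℚᵘ-toℚ a)))))

toℚ-sub : ∀ a b → toℚ (a ℤ.- b) ≡ toℚ a - toℚ b
toℚ-sub a b = trans (toℚ-+ a (ℤ.- b)) (cong (toℚ a +_) (toℚ-neg b))

toℚ-injective : ∀ {a b} → toℚ a ≡ toℚ b → a ≡ b
toℚ-injective {a} {b} eq with ℚP.fromℚᵘ-injective {ℚᵘ.mkℚᵘ a 0} {ℚᵘ.mkℚᵘ b 0} eq
... | ℚᵘ.*≡* a*1≡b*1 = trans (sym (ℤP.*-identityʳ a)) (trans a*1≡b*1 (ℤP.*-identityʳ b))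

toℚ-sumℤ : ∀ {k} (f : Fin k → ℤ) → toℚ (sumℤ f) ≡ sum (λ i → toℚ (f i))
toℚ-sumℤ {zero}  f = refl
toℚ-sumℤ {suc k} f =
  trans (toℚ-+ (f zero) (sumℤ (λ i → f (suc i)))) (cong (toℚ (f zero) +_) (toℚ-sumℤ (λ i → f (suc i))))

Solution : ∀ {m n} → (Fin m → Fin n → ℚ) → (Fin m → ℚ) → Set
Solution {n = n} A b = Σ (Fin n → ℚ) λ x → ∀ i → sum (λ k → A i k * x k) ≡ b i

Inconsistency : ∀ {m n} → (Fin m → Fin n → ℚ) → (Fin m → ℚ) → Set
Inconsistency {m} A b =
  Σ (Fin m → ℚ) λ y → (∀ k → sum (λ i → y i * A i k) ≡ 0ℚ) × sum (λ i → y i * b i) ≡ 1ℚ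

allZero-or-nonZero : ∀ {m} (f : Fin m → ℚ) → (∀ i → f i ≡ 0ℚ) ⊎ ∃ λ i → f i ≢ 0ℚ
allZero-or-nonZero f with all? (λ i → f i ℚP.≟ 0ℚ)
... | yes allZero    = inj₁ allZero
... | no notAllZero  = inj₂ (¬∀⟶∃¬ _ _ (λ i → f i ℚP.≟ 0ℚ) notAllZero)

inv : (a : ℚ) → a ≢ 0ℚ → ℚ
inv a a≢0 = ℚ.1/_ a {{ℚ.≢-nonZero a≢0}}

*-inv : ∀ a (a≢0 : a ≢ 0ℚ) → a * inv a a≢0 ≡ 1ℚ
*-inv a a≢0 = ℚP.*-inverseʳ a {{ℚ.≢-nonZero a≢0}}

≢0*x≡0⇒x≡0 : ∀ {a x} → a ≢ 0ℚ → a * x ≡ 0ℚ → x ≡ 0ℚ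
≢0*x≡0⇒x≡0 {a} {x} a≢0 ax≡0 = begin
  x                      ≡⟨ ℚP.*-identityˡ x ⟨
  1ℚ * x                 ≡⟨ cong (_* x) (trans (ℚP.*-comm (inv a a≢0) a) (*-inv a a≢0)) ⟨
  inv a a≢0 * a * x      ≡⟨ ℚP.*-assoc (inv a a≢0) a x ⟩
  inv a a≢0 * (a * x)    ≡⟨ cong (inv a a≢0 *_) ax≡0 ⟩
  inv a a≢0 * 0ℚ         ≡⟨ ℚP.*-zeroʳ (inv a a≢0) ⟩
  0ℚ                     ∎

elim-punchIn : ∀ {m} (P : Fin (suc m) → Set) (p : Fin (suc m)) →
               P p → (∀ j → P (punchIn p j)) → ∀ i → P i
elim-punchIn P p Pp Ppunch i with p ≟ᶠ i
... | yes refl = Pp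
... | no p≢i   = subst P (punchIn-punchOut p≢i) (Ppunch (punchOut p≢i))

sum-insertAt : ∀ {m} (y : Fin m → ℚ) (p : Fin (suc m)) v (g : Fin (suc m) → ℚ) →
  sum (λ i → insertAt y p v i * g i) ≡ v * g p + sum (λ j → y j * g (punchIn p j))
sum-insertAt y p v g = begin
  sum (λ i → insertAt y p v i * g i)
    ≡⟨ sum-remove {i = p} (λ i → insertAt y p v i * g i) ⟩
  insertAt y p v p * g p + sum (λ j → insertAt y p v (punchIn p j) * g (punchIn p j))
    ≡⟨ cong₂ (λ a s → a * g p + s) (insertAt-lookup y p v)
             (sum-cong-≗ (λ j → cong (_* g (punchIn p j)) (insertAt-punchIn y p v j))) ⟩
  v * g p + sum (λ j → y j * g (punchIn p j))  ∎

-- Lifting a row combination y of the reduced system: the weight −Σ yⱼcⱼ on the pivot row p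
-- cancels the multiples c j of row p that elimination subtracted from the other rows.
sum-insertAt-eliminates : ∀ {m} (p : Fin (suc m)) (y c h : Fin m → ℚ) (g : Fin (suc m) → ℚ) →
  (∀ j → g (punchIn p j) ≡ h j + c j * g p) →
  sum (λ i → insertAt y p (- sum (λ j → y j * c j)) i * g i) ≡ sum (λ j → y j * h j)
sum-insertAt-eliminates p y c h g g-rows = begin
  sum (λ i → insertAt y p (- C) i * g i)
    ≡⟨ sum-insertAt y p (- C) g ⟩
  - C * g p + sum (λ j → y j * g (punchIn p j))
    ≡⟨ cong (- C * g p +_) (sum-cong-≗ (λ j → trans (cong (y j *_) (g-rows j))
         (solve 4 (λ y h c g → y :* (h :+ c :* g) := y :* h :+ (y :* c) :* g) refl (y j) (h j) (c j) (g p)))) ⟩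
  - C * g p + sum (λ j → y j * h j + (y j * c j) * g p)
    ≡⟨ cong (- C * g p +_) (∑-distrib-+ (λ j → y j * h j) (λ j → (y j * c j) * g p)) ⟩
  - C * g p + (H + sum (λ j → (y j * c j) * g p))
    ≡⟨ cong (λ s → - C * g p + (H + s)) (*-distribʳ-sum (g p) (λ j → y j * c j)) ⟨
  - C * g p + (H + C * g p)
    ≡⟨ solve 3 (λ C g H → (:- C) :* g :+ (H :+ C :* g) := H) refl C (g p) H ⟩
  H ∎
  where
  C = sum (λ j → y j * c j)
  H = sum (λ j → y j * h j)

module Pivot {m n} (A : Fin (suc m) → Fin (suc n) → ℚ) (b : Fin (suc m) → ℚ)
             (p : Fin (suc m)) (Ap0≢0 : A p zero ≢ 0ℚ) where

  private
    a⁻¹ : ℚ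
    a⁻¹ = inv (A p zero) Ap0≢0

  c : Fin m → ℚ
  c j = A (punchIn p j) zero * a⁻¹

  A′ : Fin m → Fin n → ℚ
  A′ j k = A (punchIn p j) (suc k) - c j * A p (suc k)

  b′ : Fin m → ℚ
  b′ j = b (punchIn p j) - c j * b p

  pivot-cancels : ∀ u → A p zero * (u * a⁻¹) ≡ u
  pivot-cancels u = begin
    A p zero * (u * a⁻¹)  ≡⟨ solve 3 (λ a u i → a :* (u :* i) := u :* (a :* i)) refl (A p zero) u a⁻¹ ⟩
    u * (A p zero * a⁻¹)  ≡⟨ cong (u *_) (*-inv (A p zero) Ap0≢0) ⟩
    u * 1ℚ                ≡⟨ ℚP.*-identityʳ u ⟩
    u                     ∎

  c*pivot : ∀ j → c j * A p zero ≡ A (punchIn p j) zero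
  c*pivot j = trans (ℚP.*-comm (c j) (A p zero)) (pivot-cancels (A (punchIn p j) zero))

  liftSolution : Solution A′ b′ → Solution A b
  liftSolution (x′ , x′-solves) =
    x , elim-punchIn (λ i → sum (λ k → A i k * x k) ≡ b i) p pivotRow otherRow
    where
    S = sum (λ k → A p (suc k) * x′ k)

    x : Fin (suc n) → ℚ
    x zero    = (b p - S) * a⁻¹
    x (suc k) = x′ k

    pivotRow : sum (λ k → A p k * x k) ≡ b p
    pivotRow = begin
      A p zero * ((b p - S) * a⁻¹) + S  ≡⟨ cong (_+ S) (pivot-cancels (b p - S)) ⟩
      b p - S + S                       ≡⟨ solve 2 (λ u s → (u :- s) :+ s := u) refl (b p) S ⟩
      b p                               ∎

    otherRow : ∀ j → sum (λ k → A (punchIn p j) k * x k) ≡ b (punchIn p j)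
    otherRow j = begin
      A (punchIn p j) zero * x zero + T     ≡⟨ cong (λ a → a * x zero + T) (c*pivot j) ⟨
      c j * A p zero * x zero + T
        ≡⟨ cong (_+ T) (trans (ℚP.*-assoc (c j) (A p zero) (x zero))
                              (cong (c j *_) (pivot-cancels (b p - S)))) ⟩
      c j * (b p - S) + T
        ≡⟨ solve 4 (λ c P S T → c :* (P :- S) :+ T := (T :- c :* S) :+ c :* P) refl (c j) (b p) S T ⟩
      (T - c j * S) + c j * b p             ≡⟨ cong (_+ c j * b p) reducedRow ⟩
      (b (punchIn p j) - c j * b p) + c j * b p
        ≡⟨ solve 3 (λ B c P → (B :- c :* P) :+ c :* P := B) refl (b (punchIn p j)) (c j) (b p) ⟩
      b (punchIn p j)                        ∎
      where
      T = sum (λ k → A (punchIn p j) (suc k) * x′ k)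

      reducedRow : T - c j * S ≡ b′ j
      reducedRow = begin
        T - c j * S
          ≡⟨ cong (λ s → T - s) (*-distribˡ-sum (c j) (λ k → A p (suc k) * x′ k)) ⟩
        T - sum (λ k → c j * (A p (suc k) * x′ k))
          ≡⟨ sum-sub (λ k → A (punchIn p j) (suc k) * x′ k) (λ k → c j * (A p (suc k) * x′ k)) ⟨
        sum (λ k → A (punchIn p j) (suc k) * x′ k - c j * (A p (suc k) * x′ k))
          ≡⟨ sum-cong-≗ (λ k → solve 4 (λ u c v x → u :* x :- c :* (v :* x) := (u :- c :* v) :* x) refl
               (A (punchIn p j) (suc k)) (c j) (A p (suc k)) (x′ k)) ⟩
        sum (λ k → A′ j k * x′ k)                     ≡⟨ x′-solves j ⟩
        b′ j                                          ∎

  liftInconsistency : Inconsistency A′ b′ → Inconsistency A b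
  liftInconsistency (y′ , y′A′≡0 , y′b′≡1) = y , yA≡0 , yb≡1
    where
    y = insertAt y′ p (- sum (λ j → y′ j * c j))

    restored : ∀ u v w → u ≡ (u - w * v) + w * v
    restored u v w = solve 3 (λ u v w → u := (u :- w :* v) :+ w :* v) refl u v w

    yA≡0 : ∀ k → sum (λ i → y i * A i k) ≡ 0ℚ
    yA≡0 zero = begin
      sum (λ i → y i * A i zero)
        ≡⟨ sum-insertAt-eliminates p y′ c (λ _ → 0ℚ) (λ i → A i zero)
             (λ j → trans (sym (c*pivot j)) (sym (ℚP.+-identityˡ _))) ⟩
      sum (λ j → y′ j * 0ℚ)  ≡⟨ sum-cong-≗ (λ j → ℚP.*-zeroʳ (y′ j)) ⟩
      sum {m} (λ _ → 0ℚ)     ≡⟨ sum-replicate-zero m ⟩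
      0ℚ                     ∎
    yA≡0 (suc k) = trans (sum-insertAt-eliminates p y′ c (λ j → A′ j k) (λ i → A i (suc k))
                           (λ j → restored (A (punchIn p j) (suc k)) (A p (suc k)) (c j)))
                         (y′A′≡0 k)

    yb≡1 : sum (λ i → y i * b i) ≡ 1ℚ
    yb≡1 = trans (sum-insertAt-eliminates p y′ c b′ b (λ j → restored (b (punchIn p j)) (b p) (c j)))
                 y′b′≡1

-- The Fredholm alternative, by Gaussian elimination on the first column.
solution-or-inconsistency : ∀ n {m} (A : Fin m → Fin n → ℚ) (b : Fin m → ℚ) →
                            Solution A b ⊎ Inconsistency A b
solution-or-inconsistency zero A b with allZero-or-nonZero b
... | inj₁ b≡0 = inj₁ ((λ ()) , λ i → sym (b≡0 i))
... | inj₂ (i , bi≢0) = inj₂ (pointMass i (inv (b i) bi≢0) , (λ ()) , yb≡1)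
  where
  yb≡1 : sum (λ j → pointMass i (inv (b i) bi≢0) j * b j) ≡ 1ℚ
  yb≡1 = trans (sum-pointMass i _ b) (trans (ℚP.*-comm _ (b i)) (*-inv (b i) bi≢0))
solution-or-inconsistency (suc n) {zero} A b = inj₁ ((λ _ → 0ℚ) , λ ())
solution-or-inconsistency (suc n) {suc m} A b with allZero-or-nonZero (λ i → A i zero)
... | inj₂ (p , Ap0≢0) = Sum.map (Pivot.liftSolution A b p Ap0≢0) (Pivot.liftInconsistency A b p Ap0≢0)
                           (solution-or-inconsistency n (Pivot.A′ A b p Ap0≢0) (Pivot.b′ A b p Ap0≢0))
... | inj₁ A·0≡0 =
  Sum.map liftSolution liftInconsistency (solution-or-inconsistency n (λ i k → A i (suc k)) b)
  where
  liftSolution : Solution (λ i k → A i (suc k)) b → Solution A b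
  liftSolution (x , x-solves) = (λ { zero → 0ℚ ; (suc k) → x k }) , λ i →
    trans (cong (_+ sum (λ k → A i (suc k) * x k)) (ℚP.*-zeroʳ (A i zero)))
          (trans (ℚP.+-identityˡ _) (x-solves i))

  liftInconsistency : Inconsistency (λ i k → A i (suc k)) b → Inconsistency A b
  liftInconsistency (y , yA≡0 , yb≡1) = y , (λ { zero → yA·0≡0 ; (suc k) → yA≡0 k }) , yb≡1
    where
    yA·0≡0 : sum (λ i → y i * A i zero) ≡ 0ℚ
    yA·0≡0 = trans (sum-cong-≗ (λ i → trans (cong (y i *_) (A·0≡0 i)) (ℚP.*-zeroʳ (y i))))
                   (sum-replicate-zero (suc m))

module _ (G : Multigraph) where

  weight : Fin (n G) → Fin (n G) → ℚ
  weight v w = toℚ (ℤ.+ mult G v w)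

  laplacian : Fin (n G) → Fin (n G) → ℚ
  laplacian v w = pointMass v (sum (weight v)) w - weight v w

  Δℚ≡sum : ∀ f v → Δℚ G f v ≡ sum (λ w → weight v w * (f v - f w))
  Δℚ≡sum f v = sumℚ≡sum (λ w → weight v w * (f v - f w))

  Δℚ≡laplacian : ∀ f v → Δℚ G f v ≡ sum (λ w → laplacian v w * f w)
  Δℚ≡laplacian f v = begin
    Δℚ G f v
      ≡⟨ Δℚ≡sum f v ⟩
    sum (λ w → weight v w * (f v - f w))
      ≡⟨ sum-cong-≗ (λ w → solve 3 (λ m a b → m :* (a :- b) := m :* a :- m :* b) refl
           (weight v w) (f v) (f w)) ⟩
    sum (λ w → weight v w * f v - weight v w * f w)
      ≡⟨ sum-sub (λ w → weight v w * f v) (λ w → weight v w * f w) ⟩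
    sum (λ w → weight v w * f v) - S
      ≡⟨ cong (_- S) (*-distribʳ-sum (f v) (weight v)) ⟨
    sum (weight v) * f v - S
      ≡⟨ cong (_- S) (sum-pointMass v (sum (weight v)) f) ⟨
    sum (λ w → pointMass v (sum (weight v)) w * f w) - S
      ≡⟨ sum-sub (λ w → pointMass v (sum (weight v)) w * f w) (λ w → weight v w * f w) ⟨
    sum (λ w → pointMass v (sum (weight v)) w * f w - weight v w * f w)
      ≡⟨ sum-cong-≗ (λ w → solve 3 (λ a b c → a :* c :- b :* c := (a :- b) :* c) refl
           (pointMass v (sum (weight v)) w) (weight v w) (f w)) ⟩
    sum (λ w → laplacian v w * f w) ∎
    where
    S = sum (λ w → weight v w * f w)

  laplacian-symmetric : ∀ v w → laplacian v w ≡ laplacian w v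
  laplacian-symmetric v w = by-cases (v ≟ᶠ w)
    where
    by-cases : Dec (v ≡ w) → laplacian v w ≡ laplacian w v
    by-cases (yes refl) = refl
    by-cases (no v≢w)   = cong₂ _-_ (trans (pointMass-off _ (v≢w ∘ sym)) (sym (pointMass-off _ v≢w)))
                                    (cong (λ k → toℚ (ℤ.+ k)) (symm G v w))

  Δℚ-selfAdjoint : ∀ h f → sum (λ v → h v * Δℚ G f v) ≡ sum (λ v → f v * Δℚ G h v)
  Δℚ-selfAdjoint h f = begin
    sum (λ v → h v * Δℚ G f v)
      ≡⟨ sum-cong-≗ (λ v → cong (h v *_) (Δℚ≡laplacian f v)) ⟩
    sum (λ v → h v * sum (λ w → laplacian v w * f w))
      ≡⟨ sum-cong-≗ (λ v → *-distribˡ-sum (h v) (λ w → laplacian v w * f w)) ⟩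
    sum (λ v → sum (λ w → h v * (laplacian v w * f w)))
      ≡⟨ ∑-comm (λ v w → h v * (laplacian v w * f w)) ⟩
    sum (λ w → sum (λ v → h v * (laplacian v w * f w)))
      ≡⟨ sum-cong-≗ (λ w → sum-cong-≗ (λ v → trans (cong (λ l → h v * (l * f w)) (laplacian-symmetric v w))
           (solve 3 (λ h l f → h :* (l :* f) := f :* (l :* h)) refl (h v) (laplacian w v) (f w)))) ⟩
    sum (λ w → sum (λ v → f w * (laplacian w v * h v)))
      ≡⟨ sum-cong-≗ (λ w → *-distribˡ-sum (f w) (λ v → laplacian w v * h v)) ⟨
    sum (λ w → f w * sum (λ v → laplacian w v * h v))
      ≡⟨ sum-cong-≗ (λ w → cong (f w *_) (Δℚ≡laplacian h w)) ⟨
    sum (λ w → f w * Δℚ G h w) ∎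

  Δℚ-sub : ∀ f g u → Δℚ G (λ v → f v - g v) u ≡ Δℚ G f u - Δℚ G g u
  Δℚ-sub f g u = begin
    Δℚ G (λ v → f v - g v) u
      ≡⟨ Δℚ≡sum (λ v → f v - g v) u ⟩
    sum (λ w → weight u w * ((f u - g u) - (f w - g w)))
      ≡⟨ sum-cong-≗ (λ w → solve 5 (λ m a b c d → m :* ((a :- c) :- (b :- d)) := m :* (a :- b) :- m :* (c :- d))
           refl (weight u w) (f u) (f w) (g u) (g w)) ⟩
    sum (λ w → weight u w * (f u - f w) - weight u w * (g u - g w))
      ≡⟨ sum-sub (λ w → weight u w * (f u - f w)) (λ w → weight u w * (g u - g w)) ⟩
    sum (λ w → weight u w * (f u - f w)) - sum (λ w → weight u w * (g u - g w))
      ≡⟨ cong₂ _-_ (Δℚ≡sum f u) (Δℚ≡sum g u) ⟨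
    Δℚ G f u - Δℚ G g u ∎

  Δℚ-neg : ∀ f u → Δℚ G (λ v → - f v) u ≡ - Δℚ G f u
  Δℚ-neg f u = begin
    Δℚ G (λ v → - f v) u
      ≡⟨ Δℚ≡sum (λ v → - f v) u ⟩
    sum (λ w → weight u w * (- f u - - f w))
      ≡⟨ sum-cong-≗ (λ w → solve 3 (λ m a b → m :* ((:- a) :- (:- b)) := :- (m :* (a :- b))) refl
           (weight u w) (f u) (f w)) ⟩
    sum (λ w → - (weight u w * (f u - f w)))
      ≡⟨ sum-neg (λ w → weight u w * (f u - f w)) ⟩
    - sum (λ w → weight u w * (f u - f w))
      ≡⟨ cong -_ (Δℚ≡sum f u) ⟨
    - Δℚ G f u ∎

  Δℚ-sub-const : ∀ f c u → Δℚ G (λ v → f v - c) u ≡ Δℚ G f u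
  Δℚ-sub-const f c u = trans (Δℚ≡sum (λ v → f v - c) u) (trans (sum-cong-≗ (λ w →
    solve 4 (λ m a b c → m :* ((a :- c) :- (b :- c)) := m :* (a :- b)) refl (weight u w) (f u) (f w) c))
    (sym (Δℚ≡sum f u)))

  toℚ-Δ : ∀ f v → toℚ (Δ G f v) ≡ Δℚ G (λ w → toℚ (f w)) v
  toℚ-Δ f v = begin
    toℚ (Δ G f v)
      ≡⟨ toℚ-sumℤ (λ w → ℤ.+ mult G v w ℤ.* (f v ℤ.- f w)) ⟩
    sum (λ w → toℚ (ℤ.+ mult G v w ℤ.* (f v ℤ.- f w)))
      ≡⟨ sum-cong-≗ (λ w → trans (toℚ-* (ℤ.+ mult G v w) (f v ℤ.- f w))
                                 (cong (weight v w *_) (toℚ-sub (f v) (f w)))) ⟩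
    sum (λ w → weight v w * (toℚ (f v) - toℚ (f w)))
      ≡⟨ Δℚ≡sum (λ w → toℚ (f w)) v ⟨
    Δℚ G (λ w → toℚ (f w)) v ∎

  weight≢0 : ∀ {u w} → 0 ℕ.< mult G u w → weight u w ≢ 0ℚ
  weight≢0 0<m weight≡0 = ℕP.<-irrefl refl (subst (0 ℕ.<_) (ℤP.+-injective (toℚ-injective weight≡0)) 0<m)

  -- At a maximum u, Δy(u) = Σ_w weight(u,w)·(y u − y w) is a sum of non-negative terms.
  harmonic-max-spreads : (y : Fin (n G) → ℚ) → (∀ u → Δℚ G y u ≡ 0ℚ) →
                         ∀ {M} → (∀ i → y i ≤ y M) →
                         ∀ {u w} → 0 ℕ.< mult G u w → y u ≡ y M → y w ≡ y M
  harmonic-max-spreads y harmonic {M} max {u} {w} 0<m yu≡yM =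
    trans (sym (x∙y⁻¹≈ε⇒x≈y (y u) (y w) (≢0*x≡0⇒x≡0 (weight≢0 0<m) term≡0))) yu≡yM
    where
    term : Fin (n G) → ℚ
    term w = weight u w * (y u - y w)

    term-nonNeg : ∀ w → 0ℚ ≤ term w
    term-nonNeg w = subst (_≤ term w) (ℚP.*-zeroʳ (weight u w))
      (ℚP.*-monoˡ-≤-nonNeg (weight u w) {{ℚP.normalize-nonNeg (mult G u w) 1}}
        (≤⇒0≤- (subst (y w ≤_) (sym yu≡yM) (max w))))

    term≡0 : term w ≡ 0ℚ
    term≡0 = sum-nonNeg-≡0 term term-nonNeg (trans (sym (Δℚ≡sum y u)) (harmonic u)) w

  harmonic⇒constant : Connected G → (y : Fin (n G) → ℚ) → (∀ u → Δℚ G y u ≡ 0ℚ) →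
                      ∀ v w → y v ≡ y w
  harmonic⇒constant connected y harmonic v w with argmax v y
  ... | M , max = trans (spread (connected M v) refl) (sym (spread (connected M w) refl))
    where
    spread : ∀ {u u′} → Reachable G u u′ → y u ≡ y M → y u′ ≡ y M
    spread here               = id
    spread (step 0<m reach) yu≡yM = spread reach (harmonic-max-spreads y harmonic max 0<m yu≡yM)

  equal-Δℚ⇒equal-differences : Connected G → ∀ f g → (∀ u → Δℚ G f u ≡ Δℚ G g u) →
                               ∀ v w → f v - f w ≡ g v - g w
  equal-Δℚ⇒equal-differences connected f g Δf≡Δg v w = begin
    f v - f w
      ≡⟨ solve 4 (λ a b c e → a :- b := (a :- c) :- (b :- e) :+ (c :- e)) refl (f v) (f w) (g v) (g w) ⟩
    d v - d w + (g v - g w)  ≡⟨ cong (λ z → z - d w + (g v - g w)) d-constant ⟩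
    d w - d w + (g v - g w)  ≡⟨ solve 2 (λ a b → a :- a :+ b := b) refl (d w) (g v - g w) ⟩
    g v - g w ∎
    where
    d : Fin (n G) → ℚ
    d u = f u - g u

    d-constant : d v ≡ d w
    d-constant = harmonic⇒constant connected d
      (λ u → trans (Δℚ-sub f g u) (x≈y⇒x∙y⁻¹≈ε (Δf≡Δg u))) v w

module _ (G : Multigraph) (q : Fin (n G)) where

  reduced : Div G → Div G
  reduced D = _-D_ {G} D (point G (deg G D) q)

  point-at : ∀ k → point G k q q ≡ k
  point-at k with q ≟ᶠ q
  ... | yes _  = refl
  ... | no q≢q = ⊥-elim (q≢q refl)

  point-off : ∀ k {v} → v ≢ q → point G k q v ≡ ℤ.0ℤ
  point-off k {v} v≢q with v ≟ᶠ q
  ... | yes v≡q = ⊥-elim (v≢q v≡q)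
  ... | no _    = refl

  pairing-reduced : ∀ (D : Div G) (g : Fin (n G) → ℚ) →
                    sum (λ v → g v * toℚ (reduced D v)) ≡ sum (λ v → (g v - g q) * toℚ (D v))
  pairing-reduced D g = begin
    sum (λ v → g v * toℚ (D v ℤ.- P v))
      ≡⟨ sum-cong-≗ (λ v → trans (cong (g v *_) (toℚ-sub (D v) (P v)))
           (solve 3 (λ g a b → g :* (a :- b) := g :* a :- g :* b) refl (g v) (toℚ (D v)) (toℚ (P v)))) ⟩
    sum (λ v → g v * toℚ (D v) - g v * toℚ (P v))
      ≡⟨ sum-sub (λ v → g v * toℚ (D v)) (λ v → g v * toℚ (P v)) ⟩
    gD - sum (λ v → g v * toℚ (P v))            ≡⟨ cong (λ s → gD - s) gP ⟩
    gD - g q * sum (λ v → toℚ (D v))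
      ≡⟨ cong (λ s → gD - s) (*-distribˡ-sum (g q) (λ v → toℚ (D v))) ⟩
    gD - sum (λ v → g q * toℚ (D v))
      ≡⟨ sum-sub (λ v → g v * toℚ (D v)) (λ v → g q * toℚ (D v)) ⟨
    sum (λ v → g v * toℚ (D v) - g q * toℚ (D v))
      ≡⟨ sum-cong-≗ (λ v → solve 3 (λ a b d → a :* d :- b :* d := (a :- b) :* d) refl
           (g v) (g q) (toℚ (D v))) ⟩
    sum (λ v → (g v - g q) * toℚ (D v)) ∎
    where
    P = point G (deg G D) q
    gD = sum (λ v → g v * toℚ (D v))

    gP : sum (λ v → g v * toℚ (P v)) ≡ g q * sum (λ v → toℚ (D v))
    gP = begin
      sum (λ v → g v * toℚ (P v))
        ≡⟨ sum-supported q _ (λ v v≢q → trans (cong (λ k → g v * toℚ k) (point-off _ v≢q))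
                                              (ℚP.*-zeroʳ (g v))) ⟩
      g q * toℚ (P q)                  ≡⟨ cong (λ k → g q * toℚ k) (point-at (deg G D)) ⟩
      g q * toℚ (deg G D)              ≡⟨ cong (g q *_) (toℚ-sumℤ D) ⟩
      g q * sum (λ v → toℚ (D v))      ∎

  deg-reduced : ∀ D → deg G (reduced D) ≡ ℤ.0ℤ
  deg-reduced D = toℚ-injective (begin
    toℚ (deg G (reduced D))                  ≡⟨ toℚ-sumℤ (reduced D) ⟩
    sum (λ v → toℚ (reduced D v))            ≡⟨ sum-cong-≗ (λ v → ℚP.*-identityˡ (toℚ (reduced D v))) ⟨
    sum (λ v → 1ℚ * toℚ (reduced D v))       ≡⟨ pairing-reduced D (λ _ → 1ℚ) ⟩
    sum (λ v → (1ℚ - 1ℚ) * toℚ (D v))        ≡⟨ sum-cong-≗ (λ v → ℚP.*-zeroˡ (toℚ (D v))) ⟩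
    sum {n G} (λ _ → 0ℚ)                     ≡⟨ sum-replicate-zero (n G) ⟩
    0ℚ                                       ∎)

  -- 1q = 1 − deg(1)·(q), the right-hand side of the equation Δf₁ = 1q defining bq.
  target : Fin (n G) → ℚ
  target v = toℚ (reduced (one G) v)

  sum-*target : ∀ f → sum (λ v → f v * target v) ≡ sum (λ v → f v - f q)
  sum-*target f = trans (pairing-reduced (one G) f) (sum-cong-≗ (λ v → ℚP.*-identityʳ (f v - f q)))

-- χ G A, stated for every Subset k so that it can be computed by induction on A.
indicator : ∀ {k} → Subset k → Fin k → ℤ
indicator A v = if lookup A v then ℤ.1ℤ else ℤ.0ℤ

sumℤ-indicator : ∀ {k} (A : Subset k) → sumℤ (indicator A) ≡ ℤ.+ ∣ A ∣
sumℤ-indicator []          = refl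
sumℤ-indicator (true ∷ A)  = cong (λ k → ℤ.1ℤ ℤ.+ k) (sumℤ-indicator A)
sumℤ-indicator (false ∷ A) = trans (ℤP.+-identityˡ _) (sumℤ-indicator A)

indicator-off : ∀ {k} (A : Subset k) {v} → v ∉ A → indicator A v ≡ ℤ.0ℤ
indicator-off A {v} v∉A with lookup A v in eq
... | true  = ⊥-elim (v∉A (lookup⇒[]= v A eq))
... | false = refl

module _ (G : Multigraph) (connected : Connected G) (q : Fin (n G)) where

  -- Fredholm alternative: an obstruction y is harmonic (Δ is symmetric), hence constant,
  -- so y · target = Σ_v (y v − y q) = 0.
  exists-potential : Σ (Fin (n G) → ℚ) λ f → ∀ v → Δℚ G f v ≡ target G q v
  exists-potential with solution-or-inconsistency (n G) (laplacian G) (target G q)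
  ... | inj₁ (f , solves) = f , λ v → trans (Δℚ≡laplacian G f v) (solves v)
  ... | inj₂ (y , yL≡0 , y·target≡1) = ⊥-elim (0≢1 (trans (sym y·target≡0) y·target≡1))
    where
    0≢1 : 0ℚ ≢ 1ℚ
    0≢1 ()

    harmonic : ∀ u → Δℚ G y u ≡ 0ℚ
    harmonic u = trans (Δℚ≡laplacian G y u) (trans (sum-cong-≗ (λ v →
      trans (cong (_* y v) (laplacian-symmetric G u v)) (ℚP.*-comm (laplacian G v u) (y v)))) (yL≡0 u))

    y·target≡0 : sum (λ v → y v * target G q v) ≡ 0ℚ
    y·target≡0 = trans (sum-*target G q y) (trans
      (sum-cong-≗ (λ v → x≈y⇒x∙y⁻¹≈ε (harmonic⇒constant G connected y harmonic v q)))
      (sum-replicate-zero (n G)))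

  bq-exists : ∀ D → Σ ℚ (λ x → IsBq G q D x)
  bq-exists D =
    _ , deg-reduced G q (one G) , deg-reduced G q D , proj₁ exists-potential , proj₂ exists-potential , refl

  bq-add-Δℚ : ∀ (D E : Div G) (F : Fin (n G) → ℚ) → (∀ v → toℚ (E v) ≡ toℚ (D v) + Δℚ G F v) →
              ∀ x y → IsBq G q D x → IsBq G q E y → y ≡ x + sum (λ v → F v - F q)
  bq-add-Δℚ D E F E≡D+ΔF x y (_ , _ , f , Δf≡target , x≡) (_ , _ , g , Δg≡target , y≡) = begin
    y
      ≡⟨ trans y≡ (sumℚ≡sum (λ v → g v * toℚ (reduced G q E v))) ⟩
    sum (λ v → g v * toℚ (reduced G q E v))
      ≡⟨ pairing-reduced G q E g ⟩
    sum (λ v → (g v - g q) * toℚ (E v))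
      ≡⟨ sum-cong-≗ (λ v → cong₂ _*_ (same-differences v) (E≡D+ΔF v)) ⟩
    sum (λ v → h v * (toℚ (D v) + Δℚ G F v))
      ≡⟨ sum-cong-≗ (λ v → ℚP.*-distribˡ-+ (h v) _ _) ⟩
    sum (λ v → h v * toℚ (D v) + h v * Δℚ G F v)
      ≡⟨ ∑-distrib-+ (λ v → h v * toℚ (D v)) (λ v → h v * Δℚ G F v) ⟩
    sum (λ v → h v * toℚ (D v)) + sum (λ v → h v * Δℚ G F v)
      ≡⟨ cong₂ _+_ x≡hD (Δℚ-selfAdjoint G h F) ⟩
    x + sum (λ v → F v * Δℚ G h v)
      ≡⟨ cong (x +_) (sum-cong-≗ (λ v → cong (F v *_) (trans (Δℚ-sub-const G f (f q) v) (Δf≡target v)))) ⟩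
    x + sum (λ v → F v * target G q v)
      ≡⟨ cong (x +_) (sum-*target G q F) ⟩
    x + sum (λ v → F v - F q) ∎
    where
    h : Fin (n G) → ℚ
    h v = f v - f q

    same-differences : ∀ v → g v - g q ≡ h v
    same-differences v = equal-Δℚ⇒equal-differences G connected g f
      (λ u → trans (Δg≡target u) (sym (Δf≡target u))) v q

    x≡hD : sum (λ v → h v * toℚ (D v)) ≡ x
    x≡hD = sym (trans x≡ (trans (sumℚ≡sum (λ v → f v * toℚ (reduced G q D v)))
                                (pairing-reduced G q D f)))

  bq-add-Δ : ∀ (D : Div G) (f : Fin (n G) → ℤ) (E : Div G) → (∀ v → E v ≡ _+D_ {G} D (Δ G f) v) →
             ∀ x y → IsBq G q D x → IsBq G q E y → y ≡ x + toℚ (sumℤ (λ v → f v ℤ.- f q))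
  bq-add-Δ D f E E≡D+Δf x y bqD bqE = begin
    y                                         ≡⟨ bq-add-Δℚ D E F E≡D+ΔF x y bqD bqE ⟩
    x + sum (λ v → F v - F q)                 ≡⟨ cong (x +_) (sum-cong-≗ (λ v → toℚ-sub (f v) (f q))) ⟨
    x + sum (λ v → toℚ (f v ℤ.- f q))         ≡⟨ cong (x +_) (toℚ-sumℤ (λ v → f v ℤ.- f q)) ⟨
    x + toℚ (sumℤ (λ v → f v ℤ.- f q))        ∎
    where
    F : Fin (n G) → ℚ
    F v = toℚ (f v)

    E≡D+ΔF : ∀ v → toℚ (E v) ≡ toℚ (D v) + Δℚ G F v
    E≡D+ΔF v = trans (cong toℚ (E≡D+Δf v))
                     (trans (toℚ-+ (D v) (Δ G f v)) (cong (toℚ (D v) +_) (toℚ-Δ G f v)))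

  bq-sub-Δχ : ∀ (D : Div G) (A : Subset (n G)) → q ∉ A →
              (E : Div G) → (∀ v → E v ≡ _-D_ {G} D (Δ G (χ G A)) v) →
              ∀ x y → IsBq G q D x → IsBq G q E y → y ≡ x - toℚ (ℤ.+ ∣ A ∣)
  bq-sub-Δχ D A q∉A E E≡D-Δχ x y bqD bqE = begin
    y                                         ≡⟨ bq-add-Δℚ D E F E≡D+ΔF x y bqD bqE ⟩
    x + sum (λ v → F v - F q)                 ≡⟨ cong (x +_) (sum-cong-≗ F-q≡F) ⟩
    x + sum F                                 ≡⟨ cong (x +_) (sum-neg (λ v → toℚ (χ G A v))) ⟩
    x - sum (λ v → toℚ (χ G A v))             ≡⟨ cong (λ s → x - s) (toℚ-sumℤ (χ G A)) ⟨
    x - toℚ (sumℤ (χ G A))                    ≡⟨ cong (λ k → x - toℚ k) (sumℤ-indicator A) ⟩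
    x - toℚ (ℤ.+ ∣ A ∣)                       ∎
    where
    F : Fin (n G) → ℚ
    F v = - toℚ (χ G A v)

    F-q≡F : ∀ v → F v - F q ≡ F v
    F-q≡F v = trans (cong (λ k → F v - - toℚ k) (indicator-off A q∉A)) (ℚP.+-identityʳ (F v))

    E≡D+ΔF : ∀ v → toℚ (E v) ≡ toℚ (D v) + Δℚ G F v
    E≡D+ΔF v = begin
      toℚ (E v)                                      ≡⟨ cong toℚ (E≡D-Δχ v) ⟩
      toℚ (D v ℤ.- Δ G (χ G A) v)                    ≡⟨ toℚ-sub (D v) (Δ G (χ G A) v) ⟩
      toℚ (D v) - toℚ (Δ G (χ G A) v)                ≡⟨ cong (λ z → toℚ (D v) - z) (toℚ-Δ G (χ G A) v) ⟩
      toℚ (D v) - Δℚ G (λ w → toℚ (χ G A w)) v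
        ≡⟨ cong (toℚ (D v) +_) (Δℚ-neg G (λ w → toℚ (χ G A w)) v) ⟨
      toℚ (D v) + Δℚ G F v                           ∎

proposition4p6 : (G : Multigraph) → Connected G → (q : Fin (n G)) → (D : Div G) →
    ((f : Fin (n G) → ℤ) → (E : Div G) → (∀ v → E v ≡ _+D_ {G} D (Δ G f) v) →
      Σ ℚ (λ x → IsBq G q D x) ×
      (∀ x y → IsBq G q D x → IsBq G q E y →
        y ≡ x ℚ.+ toℚ (sumℤ (λ v → f v ℤ.- f q))))
  × ((A : Subset (n G)) → q ∉ A → (E : Div G) → (∀ v → E v ≡ _-D_ {G} D (Δ G (χ G A)) v) →
      Σ ℚ (λ x → IsBq G q D x) ×
      (∀ x y → IsBq G q D x → IsBq G q E y →
        y ≡ x ℚ.- toℚ (ℤ.+ ∣ A ∣)))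
proposition4p6 G connected q D =
    (λ f E E≡D+Δf → bq-exists G connected q D , bq-add-Δ G connected q D f E E≡D+Δf)
  , (λ A q∉A E E≡D-Δχ → bq-exists G connected q D , bq-sub-Δχ G connected q D A q∉A E E≡D-Δχ)
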